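{- In the setting described in the context, every set $u\in C$ receives in total (over Step 1 and Step 2) at most $\frac{4}{3}\cdot w(u)$.
   Context: Setting: $\mathcal{S}$ is an instance of the hereditary $3$-set packing problem, i.e., a finite family of nonempty sets of cardinality at most $3$ such that every nonempty subset of a member is a member; $w(s)=|s|-1$, $w(X)=\sum_{s\in X}w(s)$. A feasible solution is a subfamily of pairwise disjoint sets. $N(U,W)=\{x\in W:\exists u\in U:u\cap x\ne\emptyset\}$. A family $X\subseteq\mathcal{S}$ of pairwise disjoint sets is a local improvement of a feasible solution $A$ of size $|X|$ if $w(X)>w(N(X,A))$, or $w(X)=w(N(X,A))$ and $X$ contains more sets of weight $2$ than $N(X,A)$. $A$ is a feasible solution with no local improvement of size at most $10$ and $B$ is an optimum feasible solution; $A$ and $B$ consist of sets of cardinality $2$ or $3$. The conflict graph $G$ is the bipartite multigraph on $A\dot\cup B$ with exactly $|a\cap b|$ parallel edges between $a\in A$ and $b\in B$; neighbors and incident edges refer to $G$. $B_1$ is the set of $v\in B$ with exactly one neighbor in $A$; $B_2$ is the set of $v\in B$ with $w(v)=2$ having exactly two incident edges whose endpoints in $A$ are distinct. Step 1: each $v\in B_1$ sends $w(v)$ to its unique neighbor in $A$, and each $v\in B_2$ sends $1$ along each of its two edges. $C$ is the set of $u\in A$ whose total amount received in Step 1 equals exactly $w(u)$. (In this setting every $v\in B\setminus(B_1\cup B_2)$ has a neighbor in $A\setminus C$; if $w(v)=1$ it has exactly two neighbors in $A$; if $w(v)=2$ it has exactly three incident edges.) Step 2, for $v\in B\setminus(B_1\cup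 B_2)$: (a) if $w(v)=1$ and $v$ has a neighbor in $C$, that neighbor receives $\frac13$ and the neighbor in $A\setminus C$ receives $\frac23$; (b) if $w(v)=1$ and both neighbors are in $A\setminus C$, each receives $\frac12$; (c) if $w(v)=2$ and exactly one incident edge goes to $A\setminus C$, $v$ sends $\frac13$ along each edge to $C$ and $\frac43$ along the edge to $A\setminus C$; (d) if $w(v)=2$ and exactly two incident edges go to $A\setminus C$, $v$ sends along each such edge $1$ if its endpoint has weight $2$ and $\frac23$ if its endpoint has weight $1$, and sends the remaining amount (2 minus these) along the edge to $C$; (e) if $w(v)=2$ and all three incident edges go to $A\setminus C$, $v$ sends $\frac23$ along each. Amounts sent along parallel edges to the same set add up. -}

module Defs where

open import Data.Nat as ℕ using (ℕ; zero; suc; _∸_; _≤_; _<_; _≟_; _<?_)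
open import Data.Bool using (Bool; true; false; if_then_else_; not; _∧_)
open import Data.List using (List; []; _∷_; length; filter; map; foldr)
open import Data.Nat.ListAction using (sum)
open import Data.Bool.ListAction using (any)
open import Data.List.Membership.Propositional using (_∈_)
open import Data.List.Relation.Unary.All using (All)
open import Data.List.Relation.Unary.Any using (any?)
open import Data.List.Relation.Unary.AllPairs using (AllPairs)
open import Data.Fin.Subset using (Subset; _∩_; ∣_∣; _⊆_)
open import Data.Product using (_×_; Σ; ∃)
open import Data.Sum using (_⊎_)
open import Data.Empty using (⊥)
open import Relation.Nullary using (does; ¬_)
open import Relation.Binary.PropositionalEquality using (_≡_)
open import Data.Integer using (+_)
open import Data.Rational as ℚ using (ℚ)

w : ∀ {n} → Subset n → ℕ
w s = ∣ s ∣ ∸ 1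

wF : ∀ {n} → List (Subset n) → ℕ
wF X = sum (map w X)

meets : ∀ {n} → Subset n → Subset n → Bool
meets s t = does (0 <? ∣ s ∩ t ∣)

Disjoint : ∀ {n} → Subset n → Subset n → Set
Disjoint s t = ∣ s ∩ t ∣ ≡ 0

PairwiseDisjoint : ∀ {n} → List (Subset n) → Set
PairwiseDisjoint X = AllPairs Disjoint X

N : ∀ {n} → List (Subset n) → List (Subset n) → List (Subset n)
N U W = filter (λ x → any? (λ u → 0 <? ∣ u ∩ x ∣) U) W

count2 : ∀ {n} → List (Subset n) → ℕ
count2 X = length (filter (λ s → w s ≟ 2) X)

record Hereditary3SP {n : ℕ} (S : List (Subset n)) : Set where
  field
    nonempty   : ∀ {s} → s ∈ S → 1 ≤ ∣ s ∣
    atMost3    : ∀ {s} → s ∈ S → ∣ s ∣ ≤ 3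
    hereditary : ∀ {s t} → s ∈ S → t ⊆ s → 1 ≤ ∣ t ∣ → t ∈ S

Feasible : ∀ {n} → List (Subset n) → List (Subset n) → Set
Feasible S X = All (_∈ S) X × PairwiseDisjoint X

LocalImprovement : ∀ {n} → List (Subset n) → List (Subset n) → List (Subset n) → Set
LocalImprovement S A X =
  Feasible S X ×
  (wF (N X A) < wF X ⊎ (wF X ≡ wF (N X A) × count2 (N X A) < count2 X))

NoLocalImprovementUpTo : ∀ {n} → ℕ → List (Subset n) → List (Subset n) → Set
NoLocalImprovementUpTo k S A =
  ∀ X → length X ≤ k → ¬ LocalImprovement S A X

Optimum : ∀ {n} → List (Subset n) → List (Subset n) → Set
Optimum S B = Feasible S B × (∀ B' → Feasible S B' → wF B' ≤ wF B)

-- Conflict graph G on A ∪ B: |a ∩ b| parallel edges between a ∈ A, b ∈ B.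

module ConflictGraph {n : ℕ} (A B : List (Subset n)) where

  edgesBetween : Subset n → Subset n → ℕ
  edgesBetween a b = ∣ a ∩ b ∣

  nbrs : Subset n → List (Subset n)
  nbrs v = filter (λ a → 0 <? ∣ a ∩ v ∣) A

  degree : Subset n → ℕ
  degree v = sum (map (λ a → edgesBetween a v) A)

  isB1 : Subset n → Bool
  isB1 v = does (length (nbrs v) ≟ 1)

  isB2 : Subset n → Bool
  isB2 v = does (w v ≟ 2) ∧ does (degree v ≟ 2) ∧ does (length (nbrs v) ≟ 2)

  step1From : Subset n → Subset n → ℕ
  step1From u v =
    if isB1 v then (if meets u v then w v else 0)
    else (if isB2 v then edgesBetween u v else 0)

  received1 : Subset n → ℕ
  received1 u = sum (map (step1From u) B)

  inC : Subset n → Bool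
  inC u = does (received1 u ≟ w u)

  edgesToNotC : Subset n → ℕ
  edgesToNotC v = sum (map (λ a → if inC a then 0 else edgesBetween a v) A)

  hasNbrInC : Subset n → Bool
  hasNbrInC v = any (λ a → inC a ∧ meets a v) A

  q : ℕ → ℚ
  q k = + k ℚ./ 1

  third : ℚ
  third = + 1 ℚ./ 3

  twoThirds : ℚ
  twoThirds = + 2 ℚ./ 3

  half : ℚ
  half = + 1 ℚ./ 2

  fourThirds : ℚ
  fourThirds = + 4 ℚ./ 3

  -- case (d): amount sent along an edge to an endpoint a ∈ A \ C
  dAmount : Subset n → ℚ
  dAmount a = if does (w a ≟ 2) then ℚ.1ℚ else twoThirds

  -- case (d): remaining amount, sent along the edge to C
  dRemaining : Subset n → ℚ
  dRemaining v =
    q 2 ℚ.- foldr ℚ._+_ ℚ.0ℚ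
      (map (λ a → if inC a then ℚ.0ℚ else q (edgesBetween a v) ℚ.* dAmount a) A)

  step2Core : Subset n → Subset n → ℚ
  step2Core u v with w v ≟ 1 | edgesToNotC v
  ... | Relation.Nullary.yes _ | _ =
        if meets u v
        then (if inC u then third
              else (if hasNbrInC v then twoThirds else half))
        else ℚ.0ℚ
  ... | Relation.Nullary.no _ | 1 =
        q (edgesBetween u v) ℚ.* (if inC u then third else fourThirds)
  ... | Relation.Nullary.no _ | 2 =
        if inC u
        then (if meets u v then dRemaining v else ℚ.0ℚ)
        else q (edgesBetween u v) ℚ.* dAmount u
  ... | Relation.Nullary.no _ | _ =
        q (edgesBetween u v) ℚ.* twoThirds

  step2From : Subset n → Subset n → ℚ
  step2From u v = if isB1 v then ℚ.0ℚ else (if isB2 v then ℚ.0ℚ else step2Core u v)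

  receivedTotal : Subset n → ℚ
  receivedTotal u = q (received1 u) ℚ.+ foldr ℚ._+_ ℚ.0ℚ (map (step2From u) B)

{-# OPTIONS --safe #-}
-- Since u ∈ C receives exactly w(u) in Step 1, it suffices that Step 2 brings u at most w(u)/3.
-- Counted in thirds, a set of B ∖ (B₁ ∪ B₂) sends u at most 1/3 per common edge, except a set of
-- case (d) whose two edges to A ∖ C end in weight-1 sets: it sends 2/3 along its single edge to u.
-- As B is a packing, u has at most ∣u∣ edges to B.
-- If some set b of B₁ ∪ B₂ meeting u still has ∣u∣ elements after removing the other sets of A,
-- then this remainder and such a case-(d) set form a local improvement of size 2.  So every Step-2
-- set pays at most 1/3 per edge, and the edge to b leaves at most ∣u∣ − 1 = w(u) edges for Step 2.
-- Otherwise each set of B₁ ∪ B₂ sends u at most one unit per edge.  Then ∣u∣ = 2 is impossible (u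
-- would receive nothing), and for ∣u∣ = 3 Step 1 uses two of the three edges of u, leaving one
-- edge, which carries at most 2/3.
module Submission where

open import Algebra.Properties.CommutativeSemigroup using (interchange)
open import Data.Bool using (true; false; if_then_else_)
open import Data.Bool.Properties using (∧-conicalˡ; ∧-conicalʳ)
open import Data.Empty using (⊥-elim)
open import Data.Fin.Subset using (Subset; _∩_; _∪_; _─_; ⋃; ∣_∣; _⊆_)
open import Data.Fin.Subset.Properties
  using (p⊆q⇒∣p∣≤∣q∣; x∈p∩q⁺; x∈p∩q⁻; p⊆p∪q; q⊆p∪q; p─q⊆p; ∩-comm; ∩-zeroʳ; ∩-distribˡ-∪; ∣⊥∣≡0)
import Data.Integer as ℤ
import Data.Integer.Properties as ℤ
open import Data.List using (List; []; _∷_; _++_; map; filter; foldr; length)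
open import Data.List.Membership.Propositional using (_∈_; find; lose)
open import Data.List.Membership.Propositional.Properties using (∈-∃++)
open import Data.List.Relation.Binary.Permutation.Propositional using (_↭_; ↭-sym)
import Data.List.Relation.Binary.Permutation.Propositional.Properties as ↭
open import Data.List.Relation.Unary.All using ([]; _∷_)
import Data.List.Relation.Unary.All as All
open import Data.List.Relation.Unary.AllPairs using (AllPairs; []; _∷_)
open import Data.List.Relation.Unary.Any using (Any; here; there; any?)
open import Data.Nat using (ℕ; suc; _+_; _*_; _∸_; _≤_; _<_; z≤n; s≤s; _≟_; _<?_; _≤?_)
open import Data.Nat.Divisibility using (∣1⇒≡1)
open import Data.Nat.ListAction using (sum)
open import Data.Nat.ListAction.Properties using (sum-↭)
open import Data.Nat.Properties
open import Data.Product using (_×_; _,_; ∃; proj₁; proj₂)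
open import Data.Rational as ℚ using (ℚ)
import Data.Rational.Properties as ℚ
open import Algebra.Properties.Group ℚ.+-0-group using (//-rightDividesʳ)
open import Data.Sum using (_⊎_; inj₁; inj₂; [_,_]′)
open import Data.Vec using (_∷_; [])
open import Function using (id)
open import Relation.Binary.Core using (Rel)
open import Relation.Binary.PropositionalEquality
open import Relation.Nullary using (Dec; does; yes; no; ¬_)
open import Relation.Nullary.Decidable using (dec-true; _×-dec_; map′)
open import Relation.Unary using (Pred; Decidable)

open import Defs

∑ : ∀ {a} {X : Set a} → (X → ℕ) → List X → ℕ
∑ f xs = sum (map f xs)

module _ {a} {X : Set a} where

  ∑-cong : ∀ {f g : X → ℕ} xs → (∀ {x} → x ∈ xs → f x ≡ g x) → ∑ f xs ≡ ∑ g xs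
  ∑-cong []       f≡g = refl
  ∑-cong (x ∷ xs) f≡g = cong₂ _+_ (f≡g (here refl)) (∑-cong xs (λ x∈ → f≡g (there x∈)))

  ∑-mono : ∀ {f g : X → ℕ} xs → (∀ {x} → x ∈ xs → f x ≤ g x) → ∑ f xs ≤ ∑ g xs
  ∑-mono []       f≤g = z≤n
  ∑-mono (x ∷ xs) f≤g = +-mono-≤ (f≤g (here refl)) (∑-mono xs (λ x∈ → f≤g (there x∈)))

  ∑-mono-< : ∀ {f g : X → ℕ} xs → (∀ {x} → x ∈ xs → f x ≤ g x) →
             ∀ {y} → y ∈ xs → f y < g y → ∑ f xs < ∑ g xs
  ∑-mono-< (x ∷ xs) f≤g (here refl) fy<gy =
    +-mono-<-≤ fy<gy (∑-mono xs (λ x∈ → f≤g (there x∈)))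
  ∑-mono-< (x ∷ xs) f≤g (there y∈) fy<gy =
    +-mono-≤-< (f≤g (here refl)) (∑-mono-< xs (λ x∈ → f≤g (there x∈)) y∈ fy<gy)

  ∑-+ : ∀ (f g : X → ℕ) xs → ∑ (λ x → f x + g x) xs ≡ ∑ f xs + ∑ g xs
  ∑-+ f g []       = refl
  ∑-+ f g (x ∷ xs) = begin
    (f x + g x) + ∑ (λ x → f x + g x) xs ≡⟨ cong ((f x + g x) +_) (∑-+ f g xs) ⟩
    (f x + g x) + (∑ f xs + ∑ g xs)      ≡⟨ interchange +-commutativeSemigroup (f x) (g x) _ _ ⟩
    (f x + ∑ f xs) + (g x + ∑ g xs)      ∎
    where open ≡-Reasoning

  ∑-* : ∀ k (f : X → ℕ) xs → ∑ (λ x → k * f x) xs ≡ k * ∑ f xs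
  ∑-* k f []       = sym (*-zeroʳ k)
  ∑-* k f (x ∷ xs) = trans (cong (k * f x +_) (∑-* k f xs)) (sym (*-distribˡ-+ k (f x) _))

  ∑≡0⇒≡0 : ∀ (f : X → ℕ) {xs} → ∑ f xs ≡ 0 → ∀ {x} → x ∈ xs → f x ≡ 0
  ∑≡0⇒≡0 f {y ∷ xs} ∑≡0 (here refl) = m+n≡0⇒m≡0 (f y) ∑≡0
  ∑≡0⇒≡0 f {y ∷ xs} ∑≡0 (there x∈)  = ∑≡0⇒≡0 f (m+n≡0⇒n≡0 (f y) ∑≡0) x∈

  ≡0⇒∑≡0 : ∀ (f : X → ℕ) xs → (∀ {x} → x ∈ xs → f x ≡ 0) → ∑ f xs ≡ 0
  ≡0⇒∑≡0 f []       f≡0 = refl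
  ≡0⇒∑≡0 f (x ∷ xs) f≡0 = cong₂ _+_ (f≡0 (here refl)) (≡0⇒∑≡0 f xs (λ x∈ → f≡0 (there x∈)))

  ≤∑ : ∀ (f : X → ℕ) {xs x} → x ∈ xs → f x ≤ ∑ f xs
  ≤∑ f {y ∷ xs} (here refl) = m≤m+n (f y) _
  ≤∑ f {y ∷ xs} (there x∈)  = ≤-trans (≤∑ f x∈) (m≤n+m _ (f y))

  ∑-↭ : ∀ (f : X → ℕ) {xs ys} → xs ↭ ys → ∑ f xs ≡ ∑ f ys
  ∑-↭ f xs↭ys = sum-↭ (↭.map⁺ f xs↭ys)

  module _ {p} {P : Pred X p} (P? : Decidable P) where

    ∑-filter : ∀ (f : X → ℕ) xs →
               ∑ f (filter P? xs) ≡ ∑ (λ x → if does (P? x) then f x else 0) xs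
    ∑-filter f []       = refl
    ∑-filter f (x ∷ xs) with does (P? x)
    ... | true  = cong (f x +_) (∑-filter f xs)
    ... | false = ∑-filter f xs

    length-filter≡∑ : ∀ xs → length (filter P? xs) ≡ ∑ (λ x → if does (P? x) then 1 else 0) xs
    length-filter≡∑ []       = refl
    length-filter≡∑ (x ∷ xs) with does (P? x)
    ... | true  = cong suc (length-filter≡∑ xs)
    ... | false = length-filter≡∑ xs

  ∈⇒↭∷ : ∀ {x : X} {xs} → x ∈ xs → ∃ λ rest → xs ↭ x ∷ rest
  ∈⇒↭∷ {x} x∈xs with ∈-∃++ x∈xs
  ... | ys , zs , refl = ys ++ zs , ↭.shift x ys zs

  AllPairs⇒related : ∀ {ℓ} {R : Rel X ℓ} → (∀ x y → R x y → R y x) → ∀ {xs} → AllPairs R xs →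
                     ∀ {x y} → x ∈ xs → y ∈ xs → x ≢ y → R x y
  AllPairs⇒related sym (Rx ∷ _)  (here refl) (here refl) x≢y = ⊥-elim (x≢y refl)
  AllPairs⇒related sym (Rx ∷ _)  (here refl) (there y∈)  _   = All.lookup Rx y∈
  AllPairs⇒related sym (Rx ∷ _)  (there x∈)  (here refl) _   = sym _ _ (All.lookup Rx x∈)
  AllPairs⇒related sym (_ ∷ Rxs) (there x∈)  (there y∈)  x≢y = AllPairs⇒related sym Rxs x∈ y∈ x≢y

Disjoint-sym : ∀ {n} (s t : Subset n) → Disjoint s t → Disjoint t s
Disjoint-sym s t s∩t≡0 = trans (cong ∣_∣ (∩-comm t s)) s∩t≡0

∣p∩q∣+∣p─q∣≡∣p∣ : ∀ {n} (p q : Subset n) → ∣ p ∩ q ∣ + ∣ p ─ q ∣ ≡ ∣ p ∣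
∣p∩q∣+∣p─q∣≡∣p∣ []          []          = refl
∣p∩q∣+∣p─q∣≡∣p∣ (true ∷ p)  (true ∷ q)  = cong suc (∣p∩q∣+∣p─q∣≡∣p∣ p q)
∣p∩q∣+∣p─q∣≡∣p∣ (true ∷ p)  (false ∷ q) = trans (+-suc _ _) (cong suc (∣p∩q∣+∣p─q∣≡∣p∣ p q))
∣p∩q∣+∣p─q∣≡∣p∣ (false ∷ p) (true ∷ q)  = ∣p∩q∣+∣p─q∣≡∣p∣ p q
∣p∩q∣+∣p─q∣≡∣p∣ (false ∷ p) (false ∷ q) = ∣p∩q∣+∣p─q∣≡∣p∣ p q

∣p∪q∣≤∣p∣+∣q∣ : ∀ {n} (p q : Subset n) → ∣ p ∪ q ∣ ≤ ∣ p ∣ + ∣ q ∣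
∣p∪q∣≤∣p∣+∣q∣ []          []          = z≤n
∣p∪q∣≤∣p∣+∣q∣ (true ∷ p)  (true ∷ q)  = s≤s (≤-trans (∣p∪q∣≤∣p∣+∣q∣ p q) (+-monoʳ-≤ ∣ p ∣ (n≤1+n ∣ q ∣)))
∣p∪q∣≤∣p∣+∣q∣ (true ∷ p)  (false ∷ q) = s≤s (∣p∪q∣≤∣p∣+∣q∣ p q)
∣p∪q∣≤∣p∣+∣q∣ (false ∷ p) (true ∷ q)  = ≤-trans (s≤s (∣p∪q∣≤∣p∣+∣q∣ p q)) (≤-reflexive (sym (+-suc _ _)))
∣p∪q∣≤∣p∣+∣q∣ (false ∷ p) (false ∷ q) = ∣p∪q∣≤∣p∣+∣q∣ p q

∣p─q∩q∣≡0 : ∀ {n} (p q : Subset n) → ∣ (p ─ q) ∩ q ∣ ≡ 0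
∣p─q∩q∣≡0 []      []          = refl
∣p─q∩q∣≡0 (_ ∷ p) (true ∷ q)  = ∣p─q∩q∣≡0 p q
∣p─q∩q∣≡0 (true ∷ p)  (false ∷ q) = ∣p─q∩q∣≡0 p q
∣p─q∩q∣≡0 (false ∷ p) (false ∷ q) = ∣p─q∩q∣≡0 p q

∣p─q∩r∣≡∣p∩r∣ : ∀ {n} (p q r : Subset n) → Disjoint q r → ∣ (p ─ q) ∩ r ∣ ≡ ∣ p ∩ r ∣
∣p─q∩r∣≡∣p∩r∣ []          []          []          _   = refl
∣p─q∩r∣≡∣p∩r∣ (true ∷ p)  (true ∷ q)  (false ∷ r) q∩r = ∣p─q∩r∣≡∣p∩r∣ p q r q∩r
∣p─q∩r∣≡∣p∩r∣ (false ∷ p) (true ∷ q)  (false ∷ r) q∩r = ∣p─q∩r∣≡∣p∩r∣ p q r q∩r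
∣p─q∩r∣≡∣p∩r∣ (true ∷ p)  (false ∷ q) (true ∷ r)  q∩r = cong suc (∣p─q∩r∣≡∣p∩r∣ p q r q∩r)
∣p─q∩r∣≡∣p∩r∣ (true ∷ p)  (false ∷ q) (false ∷ r) q∩r = ∣p─q∩r∣≡∣p∩r∣ p q r q∩r
∣p─q∩r∣≡∣p∩r∣ (false ∷ p) (false ∷ q) (_ ∷ r)     q∩r = ∣p─q∩r∣≡∣p∩r∣ p q r q∩r

∩-monoʳ-⊆ : ∀ {n} (p : Subset n) {q r} → q ⊆ r → p ∩ q ⊆ p ∩ r
∩-monoʳ-⊆ p {q} q⊆r x∈ with x∈p∩q⁻ p q x∈
... | x∈p , x∈q = x∈p∩q⁺ (x∈p , q⊆r x∈q)

∩-monoˡ-⊆ : ∀ {n} {p q : Subset n} (r : Subset n) → p ⊆ q → p ∩ r ⊆ q ∩ r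
∩-monoˡ-⊆ {p = p} r p⊆q x∈ with x∈p∩q⁻ p r x∈
... | x∈p , x∈r = x∈p∩q⁺ (p⊆q x∈p , x∈r)

⊆⋃ : ∀ {n} {qs : List (Subset n)} {q} → q ∈ qs → q ⊆ ⋃ qs
⊆⋃ (here refl) = p⊆p∪q _
⊆⋃ {qs = q ∷ qs} (there q∈) x∈ = q⊆p∪q q (⋃ qs) (⊆⋃ q∈ x∈)

∣p∩⋃qs∣≤∑ : ∀ {n} (p : Subset n) qs → ∣ p ∩ ⋃ qs ∣ ≤ ∑ (λ q → ∣ q ∩ p ∣) qs
∣p∩⋃qs∣≤∑ {n} p []       = ≤-reflexive (trans (cong ∣_∣ (∩-zeroʳ p)) (∣⊥∣≡0 n))
∣p∩⋃qs∣≤∑ p (q ∷ qs) = begin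
  ∣ p ∩ (q ∪ ⋃ qs) ∣              ≡⟨ cong ∣_∣ (∩-distribˡ-∪ p q (⋃ qs)) ⟩
  ∣ (p ∩ q) ∪ (p ∩ ⋃ qs) ∣        ≤⟨ ∣p∪q∣≤∣p∣+∣q∣ (p ∩ q) (p ∩ ⋃ qs) ⟩
  ∣ p ∩ q ∣ + ∣ p ∩ ⋃ qs ∣        ≤⟨ +-mono-≤ (≤-reflexive (cong ∣_∣ (∩-comm p q))) (∣p∩⋃qs∣≤∑ p qs) ⟩
  ∣ q ∩ p ∣ + ∑ (λ q → ∣ q ∩ p ∣) qs ∎
  where open ≤-Reasoning

∣p∣≤∣p─⋃qs∣+∑ : ∀ {n} (p : Subset n) qs → ∣ p ∣ ≤ ∣ p ─ ⋃ qs ∣ + ∑ (λ q → ∣ q ∩ p ∣) qs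
∣p∣≤∣p─⋃qs∣+∑ p qs = begin
  ∣ p ∣                                   ≡⟨ ∣p∩q∣+∣p─q∣≡∣p∣ p (⋃ qs) ⟨
  ∣ p ∩ ⋃ qs ∣ + ∣ p ─ ⋃ qs ∣             ≤⟨ +-monoˡ-≤ _ (∣p∩⋃qs∣≤∑ p qs) ⟩
  ∑ (λ q → ∣ q ∩ p ∣) qs + ∣ p ─ ⋃ qs ∣   ≡⟨ +-comm (∑ (λ q → ∣ q ∩ p ∣) qs) _ ⟩
  ∣ p ─ ⋃ qs ∣ + ∑ (λ q → ∣ q ∩ p ∣) qs   ∎
  where open ≤-Reasoning

∣p─⋃qs∩q∣≡0 : ∀ {n} (p : Subset n) {qs q} → q ∈ qs → ∣ (p ─ ⋃ qs) ∩ q ∣ ≡ 0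
∣p─⋃qs∩q∣≡0 p {qs} {q} q∈ = n≤0⇒n≡0 (begin
  ∣ (p ─ ⋃ qs) ∩ q ∣     ≤⟨ p⊆q⇒∣p∣≤∣q∣ (∩-monoʳ-⊆ (p ─ ⋃ qs) (⊆⋃ q∈)) ⟩
  ∣ (p ─ ⋃ qs) ∩ ⋃ qs ∣  ≡⟨ ∣p─q∩q∣≡0 p (⋃ qs) ⟩
  0                      ∎)
  where open ≤-Reasoning

∑∣p∩q∣≤∣p∣ : ∀ {n} (p : Subset n) {qs} → AllPairs Disjoint qs → ∑ (λ q → ∣ p ∩ q ∣) qs ≤ ∣ p ∣
∑∣p∩q∣≤∣p∣ p {[]}     []                = z≤n
∑∣p∩q∣≤∣p∣ p {q ∷ qs} (q∩qs≡0 ∷ disj) = begin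
  ∣ p ∩ q ∣ + ∑ (λ r → ∣ p ∩ r ∣) qs        ≡⟨ cong (∣ p ∩ q ∣ +_) (∑-cong qs (λ r∈ → sym (∣p─q∩r∣≡∣p∩r∣ p q _ (All.lookup q∩qs≡0 r∈)))) ⟩
  ∣ p ∩ q ∣ + ∑ (λ r → ∣ (p ─ q) ∩ r ∣) qs  ≤⟨ +-monoʳ-≤ ∣ p ∩ q ∣ (∑∣p∩q∣≤∣p∣ (p ─ q) disj) ⟩
  ∣ p ∩ q ∣ + ∣ p ─ q ∣                     ≡⟨ ∣p∩q∣+∣p─q∣≡∣p∣ p q ⟩
  ∣ p ∣                                     ∎
  where open ≤-Reasoning

-- Amounts counted in thirds

fromℕ : ℕ → ℚ
fromℕ k = ℤ.+ k ℚ./ 1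

fromℕ≡mkℚ : ∀ k → fromℕ k ≡ ℚ.mkℚ (ℤ.+ k) 0 (λ (_ , d∣1) → ∣1⇒≡1 d∣1)
fromℕ≡mkℚ k = ℚ.normalize-coprime _

fromℕ-+ : ∀ m n → fromℕ (m + n) ≡ fromℕ m ℚ.+ fromℕ n
fromℕ-+ m n rewrite fromℕ≡mkℚ m | fromℕ≡mkℚ n =
  cong (ℚ._/ 1) (trans (ℤ.pos-+ m n) (sym (cong₂ ℤ._+_ (ℤ.*-identityʳ (ℤ.+ m)) (ℤ.*-identityʳ (ℤ.+ n)))))

fromℕ-* : ∀ m n → fromℕ (m * n) ≡ fromℕ m ℚ.* fromℕ n
fromℕ-* m n rewrite fromℕ≡mkℚ m | fromℕ≡mkℚ n = cong (ℚ._/ 1) (ℤ.pos-* m n)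

fromℕ-mono-≤ : ∀ {m n} → m ≤ n → fromℕ m ℚ.≤ fromℕ n
fromℕ-mono-≤ {m} {n} m≤n rewrite fromℕ≡mkℚ m | fromℕ≡mkℚ n =
  ℚ.*≤* (subst₂ ℤ._≤_ (sym (ℤ.*-identityʳ (ℤ.+ m))) (sym (ℤ.*-identityʳ (ℤ.+ n))) (ℤ.+≤+ m≤n))

oneThird : ℚ
oneThird = ℤ.+ 1 ℚ./ 3

-- Opaque, as otherwise goals mentioning amounts get normalised through the gcd inside ℚ._/_.
opaque
  thirds : ℕ → ℚ
  thirds k = fromℕ k ℚ.* oneThird

opaque
  unfolding thirds

  fromℕ*oneThird≡thirds : ∀ k → fromℕ k ℚ.* oneThird ≡ thirds k
  fromℕ*oneThird≡thirds k = refl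

  thirds-0 : thirds 0 ≡ ℚ.0ℚ
  thirds-0 = refl

  thirds-1 : thirds 1 ≡ oneThird
  thirds-1 = refl

  thirds-2 : thirds 2 ≡ ℤ.+ 2 ℚ./ 3
  thirds-2 = refl

  thirds-3 : thirds 3 ≡ ℚ.1ℚ
  thirds-3 = refl

  thirds-6 : thirds 6 ≡ fromℕ 2
  thirds-6 = refl

  thirds-+ : ∀ m n → thirds (m + n) ≡ thirds m ℚ.+ thirds n
  thirds-+ m n rewrite fromℕ-+ m n = ℚ.*-distribʳ-+ oneThird (fromℕ m) (fromℕ n)

  thirds-* : ∀ m n → thirds (m * n) ≡ fromℕ m ℚ.* thirds n
  thirds-* m n rewrite fromℕ-* m n = ℚ.*-assoc (fromℕ m) (fromℕ n) oneThird

  thirds-mono-≤ : ∀ {m n} → m ≤ n → thirds m ℚ.≤ thirds n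
  thirds-mono-≤ m≤n = ℚ.*-monoʳ-≤-nonNeg oneThird (fromℕ-mono-≤ m≤n)

thirds-nonNeg : ∀ m → ℚ.0ℚ ℚ.≤ thirds m
thirds-nonNeg m = subst (ℚ._≤ thirds m) thirds-0 (thirds-mono-≤ {0} {m} z≤n)

2-thirds≡thirds[6∸] : ∀ {k} → k ≤ 6 → fromℕ 2 ℚ.- thirds k ≡ thirds (6 ∸ k)
2-thirds≡thirds[6∸] {k} k≤6 = begin
  fromℕ 2 ℚ.- thirds k                        ≡⟨ cong (ℚ._- thirds k) thirds-6 ⟨
  thirds 6 ℚ.- thirds k                       ≡⟨ cong (λ m → thirds m ℚ.- thirds k) (m∸n+n≡m k≤6) ⟨
  thirds (6 ∸ k + k) ℚ.- thirds k             ≡⟨ cong (ℚ._- thirds k) (thirds-+ (6 ∸ k) k) ⟩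
  (thirds (6 ∸ k) ℚ.+ thirds k) ℚ.- thirds k  ≡⟨ //-rightDividesʳ (thirds k) (thirds (6 ∸ k)) ⟩
  thirds (6 ∸ k)                              ∎
  where open ≡-Reasoning

fromℕ+thirds≡4/3* : ∀ m → fromℕ m ℚ.+ thirds m ≡ (ℤ.+ 4 ℚ./ 3) ℚ.* fromℕ m
fromℕ+thirds≡4/3* m = begin
  fromℕ m ℚ.+ thirds m                          ≡⟨ cong₂ ℚ._+_ (ℚ.*-identityʳ (fromℕ m)) (fromℕ*oneThird≡thirds m) ⟨
  fromℕ m ℚ.* ℚ.1ℚ ℚ.+ fromℕ m ℚ.* oneThird     ≡⟨ ℚ.*-distribˡ-+ (fromℕ m) ℚ.1ℚ oneThird ⟨
  fromℕ m ℚ.* (ℤ.+ 4 ℚ./ 3)                       ≡⟨ ℚ.*-comm (fromℕ m) _ ⟩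
  (ℤ.+ 4 ℚ./ 3) ℚ.* fromℕ m                       ∎
  where open ≡-Reasoning

module _ {a} {X : Set a} where

  ∑ℚ : (X → ℚ) → List X → ℚ
  ∑ℚ f xs = foldr ℚ._+_ ℚ.0ℚ (map f xs)

  ∑ℚ≤thirds∑ : ∀ (f : X → ℚ) (g : X → ℕ) xs → (∀ {x} → x ∈ xs → f x ℚ.≤ thirds (g x)) →
               ∑ℚ f xs ℚ.≤ thirds (∑ g xs)
  ∑ℚ≤thirds∑ f g []       f≤g = ℚ.≤-reflexive (sym thirds-0)
  ∑ℚ≤thirds∑ f g (x ∷ xs) f≤g = ℚ.≤-trans
    (ℚ.+-mono-≤ (f≤g (here refl)) (∑ℚ≤thirds∑ f g xs (λ x∈ → f≤g (there x∈))))
    (ℚ.≤-reflexive (sym (thirds-+ (g x) (∑ g xs))))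

  ∑ℚ≡thirds∑ : ∀ (f : X → ℚ) (g : X → ℕ) xs → (∀ x → f x ≡ thirds (g x)) →
               ∑ℚ f xs ≡ thirds (∑ g xs)
  ∑ℚ≡thirds∑ f g []       f≡g = sym thirds-0
  ∑ℚ≡thirds∑ f g (x ∷ xs) f≡g =
    trans (cong₂ ℚ._+_ (f≡g x) (∑ℚ≡thirds∑ f g xs f≡g)) (sym (thirds-+ (g x) (∑ g xs)))

-- Local improvements of size two

indicator≡2 : ℕ → ℕ
indicator≡2 k = if does (k ≟ 2) then 1 else 0

count2≡∑ : ∀ {n} (X : List (Subset n)) → count2 X ≡ ∑ (λ s → indicator≡2 (w s)) X
count2≡∑ = length-filter≡∑ (λ s → w s ≟ 2)

lexicographicGain : ∀ {WN CN wu wc Iu Ic} → WN ≤ wu + 2 → CN ≤ Iu → wu ≤ wc →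
                    (wu ≡ wc → Iu ≡ Ic) → WN < wc + 2 ⊎ (wc + 2 ≡ WN × CN < Ic + 1)
lexicographicGain {WN} {CN} {wu} {wc} {Iu} {Ic} WN≤ CN≤ wu≤wc sameI with WN <? wc + 2
... | yes WN< = inj₁ WN<
... | no WN≮ = inj₂ (≤-antisym wc+2≤WN (≤-trans WN≤ (+-monoˡ-≤ 2 wu≤wc)) , CN<Ic+1)
  where
  wc+2≤WN : wc + 2 ≤ WN
  wc+2≤WN = ≮⇒≥ WN≮
  wu≡wc : wu ≡ wc
  wu≡wc = ≤-antisym wu≤wc (+-cancelʳ-≤ 2 wc wu (≤-trans wc+2≤WN WN≤))
  CN<Ic+1 : CN < Ic + 1
  CN<Ic+1 = ≤-trans (s≤s (≤-trans CN≤ (≤-reflexive (sameI wu≡wc)))) (≤-reflexive (+-comm 1 Ic))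

module _ {n} (S : List (Subset n)) {A : List (Subset n)} {u rest} (A↭ : A ↭ u ∷ rest)
         {c v : Subset n} (c∩rest≡0 : ∀ {a} → a ∈ rest → Disjoint c a) where

  private
    X : List (Subset n)
    X = c ∷ v ∷ []

    ∑N≤ : ∀ (g h : Subset n → ℕ) → (∀ {a} → a ∈ rest → 0 < ∣ a ∩ v ∣ → g a ≤ h a) →
          ∑ g (N X A) ≤ g u + ∑ h rest
    ∑N≤ g h g≤h = begin
      ∑ g (N X A)                                 ≡⟨ ∑-filter P? g A ⟩
      ∑ (λ a → if does (P? a) then g a else 0) A  ≡⟨ ∑-↭ _ A↭ ⟩
      (if does (P? u) then g u else 0) + ∑ (λ a → if does (P? a) then g a else 0) rest
                                                  ≤⟨ +-mono-≤ (if≤ (does (P? u))) (∑-mono rest pointwise) ⟩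
      g u + ∑ h rest                              ∎
      where
      open ≤-Reasoning
      P? : ∀ a → Dec (Any (λ x → 0 < ∣ x ∩ a ∣) X)
      P? a = any? (λ x → 0 <? ∣ x ∩ a ∣) X
      if≤ : ∀ b → (if b then g u else 0) ≤ g u
      if≤ true  = ≤-refl
      if≤ false = z≤n
      pointwise : ∀ {a} → a ∈ rest → (if does (P? a) then g a else 0) ≤ h a
      pointwise {a} a∈ = meetsX≤ (P? a)
        where
        meetsX≤ : (d : Dec (Any (λ x → 0 < ∣ x ∩ a ∣) X)) → (if does d then g a else 0) ≤ h a
        meetsX≤ (yes (here 0<c∩a))         = ⊥-elim (<⇒≢ 0<c∩a (sym (c∩rest≡0 a∈)))
        meetsX≤ (yes (there (here 0<v∩a))) = g≤h a∈ (subst (0 <_) (cong ∣_∣ (∩-comm v a)) 0<v∩a)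
        meetsX≤ (no _)                     = z≤n

  twoSetImprovement : c ∈ S → v ∈ S → Disjoint c v → ∣ u ∣ ≤ ∣ c ∣ → w v ≡ 2 →
                      (∀ {a} → a ∈ rest → 0 < ∣ a ∩ v ∣ → w a ≡ 1) →
                      ∑ (λ a → ∣ a ∩ v ∣) rest ≤ 2 → LocalImprovement S A (c ∷ v ∷ [])
  twoSetImprovement c∈S v∈S c∩v≡0 ∣u∣≤∣c∣ wv≡2 light fewEdges =
    ((c∈S ∷ v∈S ∷ []) , ((c∩v≡0 ∷ []) ∷ [] ∷ [])) ,
    subst₂ (λ W C → wF (N X A) < W ⊎ (W ≡ wF (N X A) × count2 (N X A) < C)) (sym wX) (sym cX)
      (lexicographicGain wN≤ cN≤ (∸-monoˡ-≤ 1 ∣u∣≤∣c∣) (cong indicator≡2))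
    where
    wX : wF X ≡ w c + 2
    wX = cong (λ k → w c + (k + 0)) wv≡2
    cX : count2 X ≡ indicator≡2 (w c) + 1
    cX = trans (count2≡∑ X) (cong (λ k → indicator≡2 (w c) + (indicator≡2 k + 0)) wv≡2)
    wN≤ : wF (N X A) ≤ w u + 2
    wN≤ = ≤-trans (∑N≤ w (λ a → ∣ a ∩ v ∣) (λ a∈ 0<a∩v → ≤-trans (≤-reflexive (light a∈ 0<a∩v)) 0<a∩v))
                  (+-monoʳ-≤ (w u) fewEdges)
    cN≤ : count2 (N X A) ≤ indicator≡2 (w u)
    cN≤ = begin
      count2 (N X A)                                ≡⟨ count2≡∑ (N X A) ⟩
      ∑ (λ s → indicator≡2 (w s)) (N X A)           ≤⟨ ∑N≤ (λ s → indicator≡2 (w s)) (λ _ → 0)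
                                                          (λ a∈ 0<a∩v → ≤-reflexive (cong indicator≡2 (light a∈ 0<a∩v))) ⟩
      indicator≡2 (w u) + ∑ (λ _ → 0) rest          ≡⟨ cong (indicator≡2 (w u) +_) (≡0⇒∑≡0 (λ _ → 0) rest (λ _ → refl)) ⟩
      indicator≡2 (w u) + 0                         ≡⟨ +-identityʳ _ ⟩
      indicator≡2 (w u)                             ∎
      where open ≤-Reasoning

does≡true⇒ : ∀ {p} {P : Set p} (P? : Dec P) → does P? ≡ true → P
does≡true⇒ (yes p) _ = p

meets⇒0< : ∀ {n} (s t : Subset n) → meets s t ≡ true → 0 < ∣ s ∩ t ∣
meets⇒0< s t = does≡true⇒ (0 <? ∣ s ∩ t ∣)

module _ {n} (A B : List (Subset n)) where
  open ConflictGraph A B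

  edgesToC : Subset n → ℕ
  edgesToC v = ∑ (λ a → if inC a then edgesBetween a v else 0) A

  edgesToC+edgesToNotC≡degree : ∀ v → edgesToC v + edgesToNotC v ≡ degree v
  edgesToC+edgesToNotC≡degree v =
    trans (sym (∑-+ (λ a → if inC a then edgesBetween a v else 0) _ A)) (∑-cong A split)
    where
    split : ∀ {a} → a ∈ A → (if inC a then edgesBetween a v else 0) + (if inC a then 0 else edgesBetween a v)
                            ≡ edgesBetween a v
    split {a} _ with inC a
    ... | true  = +-identityʳ _
    ... | false = refl

  dAmountThirds : Subset n → ℕ
  dAmountThirds a = if does (w a ≟ 2) then 3 else 2

  dSentThirds : Subset n → ℕ
  dSentThirds v = ∑ (λ a → if inC a then 0 else edgesBetween a v * dAmountThirds a) A

  dRemaining≡thirds : ∀ v → dSentThirds v ≤ 6 → dRemaining v ≡ thirds (6 ∸ dSentThirds v)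
  dRemaining≡thirds v dSentThirds≤6 =
    trans (cong (λ x → fromℕ 2 ℚ.- x) (∑ℚ≡thirds∑ _ _ A sent)) (2-thirds≡thirds[6∸] dSentThirds≤6)
    where
    amount≡thirds : ∀ b → (if b then ℚ.1ℚ else twoThirds) ≡ thirds (if b then 3 else 2)
    amount≡thirds true  = sym thirds-3
    amount≡thirds false = sym thirds-2
    sent : ∀ a → (if inC a then ℚ.0ℚ else q (edgesBetween a v) ℚ.* dAmount a)
                 ≡ thirds (if inC a then 0 else edgesBetween a v * dAmountThirds a)
    sent a with inC a
    ... | true  = sym thirds-0
    ... | false = trans (cong (q (edgesBetween a v) ℚ.*_) (amount≡thirds (does (w a ≟ 2))))
                        (sym (thirds-* (edgesBetween a v) (dAmountThirds a)))

  private
    2*edgeOutsideC≤ : ∀ v a → 2 * (if inC a then 0 else edgesBetween a v)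
                      ≤ (if inC a then 0 else edgesBetween a v * dAmountThirds a)
    2*edgeOutsideC≤ v a with inC a
    ... | true  = z≤n
    ... | false = ≤-trans (≤-reflexive (*-comm 2 (edgesBetween a v))) (*-monoʳ-≤ (edgesBetween a v) (2≤ (does (w a ≟ 2))))
      where
      2≤ : ∀ b → 2 ≤ (if b then 3 else 2)
      2≤ true  = n≤1+n 2
      2≤ false = ≤-refl

  2*edgesToNotC≤dSentThirds : ∀ v → 2 * edgesToNotC v ≤ dSentThirds v
  2*edgesToNotC≤dSentThirds v = ≤-trans (≤-reflexive (sym (∑-* 2 _ A))) (∑-mono A (λ {a} _ → 2*edgeOutsideC≤ v a))

  dSentThirds≤3*edgesToNotC : ∀ v → dSentThirds v ≤ 3 * edgesToNotC v
  dSentThirds≤3*edgesToNotC v = ≤-trans (∑-mono A (λ {a} _ → edgeOutsideC≤3* a)) (≤-reflexive (∑-* 3 _ A))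
    where
    edgeOutsideC≤3* : ∀ a → (if inC a then 0 else edgesBetween a v * dAmountThirds a)
                    ≤ 3 * (if inC a then 0 else edgesBetween a v)
    edgeOutsideC≤3* a with inC a
    ... | true  = z≤n
    ... | false = ≤-trans (*-monoʳ-≤ (edgesBetween a v) (≤3 (does (w a ≟ 2)))) (≤-reflexive (*-comm (edgesBetween a v) 3))
      where
      ≤3 : ∀ b → (if b then 3 else 2) ≤ 3
      ≤3 true  = ≤-refl
      ≤3 false = n≤1+n 2

  weight2Neighbour⇒2*edgesToNotC<dSentThirds : ∀ {v a} → a ∈ A → inC a ≡ false → 0 < edgesBetween a v → w a ≡ 2 →
                                 2 * edgesToNotC v < dSentThirds v
  weight2Neighbour⇒2*edgesToNotC<dSentThirds {v} {a} a∈A a∉C 0<e wa≡2 =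
    ≤-<-trans (≤-reflexive (sym (∑-* 2 _ A))) (∑-mono-< A (λ {a} _ → 2*edgeOutsideC≤ v a) a∈A strict)
    where
    strict : 2 * (if inC a then 0 else edgesBetween a v) < (if inC a then 0 else edgesBetween a v * dAmountThirds a)
    strict rewrite a∉C | dec-true (w a ≟ 2) wa≡2 = begin-strict
      2 * e       <⟨ m<m+n (2 * e) 0<e ⟩
      2 * e + e   ≡⟨ +-comm (2 * e) e ⟩
      3 * e       ≡⟨ *-comm 3 e ⟩
      e * 3       ∎
      where
      open ≤-Reasoning
      e = edgesBetween a v

  Step2Shape : Set
  Step2Shape = ∀ {v} → v ∈ B → isB1 v ≡ false → isB2 v ≡ false →
               Any (λ a → inC a ≡ false × meets a v ≡ true) A
               × (w v ≡ 1 → length (nbrs v) ≡ 2)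
               × (w v ≡ 2 → degree v ≡ 3)

  neighbourOutsideC⇒0<edgesToNotC : ∀ {v} → Any (λ a → inC a ≡ false × meets a v ≡ true) A → 0 < edgesToNotC v
  neighbourOutsideC⇒0<edgesToNotC {v} any with find any
  ... | a , a∈A , a∉C , m = <-≤-trans (meets⇒0< a v m) (≤-trans (≤-reflexive (cong (λ c → if c then 0 else edgesBetween a v) (sym a∉C)))
                                                       (≤∑ (λ a → if inC a then 0 else edgesBetween a v) a∈A))

-- The charge received by a set u ∈ C

Sizes2or3 : ∀ {n} → List (Subset n) → Set
Sizes2or3 X = ∀ {a} → a ∈ X → ∣ a ∣ ≡ 2 ⊎ ∣ a ∣ ≡ 3

weight≡1⊎2 : ∀ {n} {X : List (Subset n)} → Sizes2or3 X → ∀ {a} → a ∈ X → w a ≡ 1 ⊎ w a ≡ 2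
weight≡1⊎2 sizes a∈ with sizes a∈
... | inj₁ ∣a∣≡2 = inj₁ (cong (_∸ 1) ∣a∣≡2)
... | inj₂ ∣a∣≡3 = inj₂ (cong (_∸ 1) ∣a∣≡3)

module Charging {n} {S A B : List (Subset n)} (her : Hereditary3SP S)
  (noImprovement : NoLocalImprovementUpTo 10 S A) (B-feasible : Feasible S B)
  (sizesA : Sizes2or3 A) (sizesB : Sizes2or3 B) (shape : Step2Shape A B)
  {u rest} (A↭ : A ↭ u ∷ rest) (u∈C : ConflictGraph.inC A B u ≡ true) where

  open ConflictGraph A B

  u∈A : u ∈ A
  u∈A = ↭.∈-resp-↭ (↭-sym A↭) (here refl)

  rest⊆A : ∀ {a} → a ∈ rest → a ∈ A
  rest⊆A a∈ = ↭.∈-resp-↭ (↭-sym A↭) (there a∈)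

  otherEdges : Subset n → ℕ
  otherEdges b = ∑ (λ a → edgesBetween a b) rest

  degree≡ : ∀ b → degree b ≡ edgesBetween u b + otherEdges b
  degree≡ b = ∑-↭ (λ a → edgesBetween a b) A↭

  step1Edges : Subset n → ℕ
  step1Edges b = if isB1 b then edgesBetween u b else if isB2 b then edgesBetween u b else 0

  step2Edges : Subset n → ℕ
  step2Edges b = if isB1 b then 0 else if isB2 b then 0 else edgesBetween u b

  step1Edges+step2Edges≡ : ∀ b → step1Edges b + step2Edges b ≡ edgesBetween u b
  step1Edges+step2Edges≡ b with isB1 b | isB2 b
  ... | true  | _     = +-identityʳ _
  ... | false | true  = +-identityʳ _
  ... | false | false = refl

  -- b ∖ ⋃ rest has at least ∣ u ∣ elements (by ∣p∣≤∣p─⋃qs∣+∑), so it could take the place of u.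
  record Replaces (b : Subset n) : Set where
    constructor replaces
    field
      step1Edge : 0 < step1Edges b
      fits      : ∣ u ∣ + otherEdges b ≤ ∣ b ∣

  replaces? : ∀ b → Dec (Replaces b)
  replaces? b = map′ (λ (e , f) → replaces e f) (λ r → Replaces.step1Edge r , Replaces.fits r)
                     ((0 <? step1Edges b) ×-dec (∣ u ∣ + otherEdges b ≤? ∣ b ∣))

  B1⇒otherEdges≡0 : ∀ {b} → isB1 b ≡ true → 0 < edgesBetween u b → otherEdges b ≡ 0
  B1⇒otherEdges≡0 {b} b∈B1 0<e = ≡0⇒∑≡0 _ rest (λ a∈ → noEdge (∑≡0⇒≡0 meets? ∑rest≡0 a∈))
    where
    meets? : Subset n → ℕ
    meets? a = if does (0 <? edgesBetween a b) then 1 else 0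
    noEdge : ∀ {k} → (if does (0 <? k) then 1 else 0) ≡ 0 → k ≡ 0
    noEdge {0} _ = refl
    ∑rest≡0 : ∑ meets? rest ≡ 0
    ∑rest≡0 = suc-injective (begin
      suc (∑ meets? rest)          ≡⟨ cong (λ d → (if d then 1 else 0) + ∑ meets? rest) (dec-true (0 <? edgesBetween u b) 0<e) ⟨
      meets? u + ∑ meets? rest     ≡⟨ ∑-↭ meets? A↭ ⟨
      ∑ meets? A                   ≡⟨ length-filter≡∑ (λ a → 0 <? edgesBetween a b) A ⟨
      length (nbrs b)              ≡⟨ does≡true⇒ (length (nbrs b) ≟ 1) b∈B1 ⟩
      1                            ∎)
      where open ≡-Reasoning

  B2⇒shape : ∀ {b} → isB2 b ≡ true → w b ≡ 2 × degree b ≡ 2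
  B2⇒shape {b} b∈B2 =
    does≡true⇒ (w b ≟ 2) (∧-conicalˡ (does (w b ≟ 2)) _ b∈B2) ,
    does≡true⇒ (degree b ≟ 2) (∧-conicalˡ (does (degree b ≟ 2)) _ (∧-conicalʳ (does (w b ≟ 2)) _ b∈B2))

  step1Edges-B1⊎B2 : ∀ {b} → isB1 b ≡ true ⊎ isB2 b ≡ true → step1Edges b ≡ edgesBetween u b
  step1Edges-B1⊎B2 {b} b∈B1⊎B2 with isB1 b | b∈B1⊎B2
  ... | true  | _                = refl
  ... | false | inj₂ b∈B2 rewrite b∈B2 = refl

  ∣u∣≤3 : ∣ u ∣ ≤ 3
  ∣u∣≤3 with sizesA u∈A
  ... | inj₁ ∣u∣≡2 = ≤-trans (≤-reflexive ∣u∣≡2) (n≤1+n 2)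
  ... | inj₂ ∣u∣≡3 = ≤-reflexive ∣u∣≡3

  2≤∣u∣ : 2 ≤ ∣ u ∣
  2≤∣u∣ with sizesA u∈A
  ... | inj₁ ∣u∣≡2 = ≤-reflexive (sym ∣u∣≡2)
  ... | inj₂ ∣u∣≡3 = ≤-trans (n≤1+n 2) (≤-reflexive (sym ∣u∣≡3))

  B1⇒replaces : ∀ {b} → isB1 b ≡ true → 0 < edgesBetween u b → ∣ u ∣ ≤ ∣ b ∣ → Replaces b
  B1⇒replaces {b} b∈B1 0<e ∣u∣≤∣b∣ =
    replaces (subst (0 <_) (sym (step1Edges-B1⊎B2 (inj₁ b∈B1))) 0<e)
    (subst (λ k → ∣ u ∣ + k ≤ ∣ b ∣) (sym (B1⇒otherEdges≡0 b∈B1 0<e)) (≤-trans (≤-reflexive (+-identityʳ _)) ∣u∣≤∣b∣))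

  B2⇒replaces : ∀ {b} → b ∈ B → isB2 b ≡ true → 0 < edgesBetween u b → ∣ u ∣ ≡ 2 → Replaces b
  B2⇒replaces {b} b∈B b∈B2 0<e ∣u∣≡2 = replaces (subst (0 <_) (sym (step1Edges-B1⊎B2 (inj₂ b∈B2))) 0<e) (begin
    ∣ u ∣ + otherEdges b  ≤⟨ +-mono-≤ (≤-reflexive ∣u∣≡2) otherEdges≤1 ⟩
    3                     ≡⟨ ∣b∣≡3 ⟨
    ∣ b ∣                 ∎)
    where
    open ≤-Reasoning
    otherEdges≤1 : otherEdges b ≤ 1
    otherEdges≤1 = +-cancelˡ-≤ 1 _ _ (begin
      1 + otherEdges b                 ≤⟨ +-monoˡ-≤ (otherEdges b) 0<e ⟩
      edgesBetween u b + otherEdges b  ≡⟨ degree≡ b ⟨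
      degree b                         ≡⟨ proj₂ (B2⇒shape {b} b∈B2) ⟩
      2                                ∎)
    ∣b∣≡3 : ∣ b ∣ ≡ 3
    ∣b∣≡3 with sizesB b∈B | proj₁ (B2⇒shape {b} b∈B2)
    ... | inj₁ ∣b∣≡2 | wb≡2 with () ← trans (sym (cong (_∸ 1) ∣b∣≡2)) wb≡2
    ... | inj₂ ∣b∣≡3 | _ = ∣b∣≡3

  step1From≤step1Edges : ∀ {b} → b ∈ B → ¬ Replaces b → step1From u b ≤ step1Edges b
  step1From≤step1Edges {b} b∈B ¬rep with isB1 b in b∈B1 | isB2 b
  ... | false | true  = ≤-refl
  ... | false | false = z≤n
  ... | true  | _ with meets u b in m
  ...   | false = z≤n
  ...   | true with sizesB b∈B
  ...     | inj₁ ∣b∣≡2 = subst (_≤ edgesBetween u b) (sym (cong (_∸ 1) ∣b∣≡2)) (meets⇒0< u b m)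
  ...     | inj₂ ∣b∣≡3 = ⊥-elim (¬rep (B1⇒replaces b∈B1 (meets⇒0< u b m) (subst (∣ u ∣ ≤_) (sym ∣b∣≡3) ∣u∣≤3)))

  step1From≡0 : ∣ u ∣ ≡ 2 → ∀ {b} → b ∈ B → ¬ Replaces b → step1From u b ≡ 0
  step1From≡0 ∣u∣≡2 {b} b∈B ¬rep with isB1 b in b∈B1 | isB2 b in b∈B2
  ... | false | false = refl
  ... | false | true with 0 <? edgesBetween u b
  ...   | yes 0<e = ⊥-elim (¬rep (B2⇒replaces b∈B b∈B2 0<e ∣u∣≡2))
  ...   | no ¬0<e = n≤0⇒n≡0 (≮⇒≥ ¬0<e)
  step1From≡0 ∣u∣≡2 {b} b∈B ¬rep | true | _ with meets u b in m
  ...   | false = refl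
  ...   | true  = ⊥-elim (¬rep (B1⇒replaces b∈B1 (meets⇒0< u b m) ∣u∣≤∣b∣))
    where
    ∣u∣≤∣b∣ : ∣ u ∣ ≤ ∣ b ∣
    ∣u∣≤∣b∣ with sizesB b∈B
    ... | inj₁ ∣b∣≡2 = ≤-reflexive (trans ∣u∣≡2 (sym ∣b∣≡2))
    ... | inj₂ ∣b∣≡3 = ≤-trans ∣u∣≤3 (≤-reflexive (sym ∣b∣≡3))

  -- A case-(d) set that pays u 2/3 through one edge (see mkGenerous); the fields are what the
  -- improvement of size 2 needs.
  record Generous (v : Subset n) : Set where
    field
      v∈B      : v ∈ B
      notB1    : isB1 v ≡ false
      notB2    : isB2 v ≡ false
      w≡2      : w v ≡ 2
      light    : ∀ {a} → a ∈ rest → 0 < edgesBetween a v → w a ≡ 1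
      fewEdges : otherEdges v ≤ 2

  replaces⇒¬generous : ∀ {b v} → b ∈ B → Replaces b → ¬ Generous v
  replaces⇒¬generous {b} {v} b∈B rep gen =
    noImprovement (c ∷ v ∷ []) (s≤s (s≤s z≤n))
      (twoSetImprovement S A↭ (∣p─⋃qs∩q∣≡0 b) c∈S (B⊆S v∈B) c∩v≡0 ∣u∣≤∣c∣ w≡2 light fewEdges)
    where
    open Generous gen
    c : Subset n
    c = b ─ ⋃ rest
    B⊆S : ∀ {x} → x ∈ B → x ∈ S
    B⊆S = All.lookup (proj₁ B-feasible)
    step1Edges-v≡0 : step1Edges v ≡ 0
    step1Edges-v≡0 rewrite notB1 | notB2 = refl
    b≢v : b ≢ v
    b≢v refl = <⇒≢ (Replaces.step1Edge rep) (sym step1Edges-v≡0)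
    c∩v≡0 : Disjoint c v
    c∩v≡0 = n≤0⇒n≡0 (≤-trans (p⊆q⇒∣p∣≤∣q∣ (∩-monoˡ-⊆ v (p─q⊆p b (⋃ rest))))
                              (≤-reflexive (AllPairs⇒related {R = Disjoint} Disjoint-sym (proj₂ B-feasible) b∈B v∈B b≢v)))
    ∣u∣≤∣c∣ : ∣ u ∣ ≤ ∣ c ∣
    ∣u∣≤∣c∣ = +-cancelʳ-≤ (otherEdges b) _ _ (≤-trans (Replaces.fits rep) (∣p∣≤∣p─⋃qs∣+∑ b rest))
    c∈S : c ∈ S
    c∈S = Hereditary3SP.hereditary her (B⊆S b∈B) (p─q⊆p b (⋃ rest)) (≤-trans (≤-trans (n≤1+n 1) 2≤∣u∣) ∣u∣≤∣c∣)

  mkGenerous : ∀ {v} → v ∈ B → isB1 v ≡ false → isB2 v ≡ false → w v ≡ 2 → edgesToNotC v ≡ 2 →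
             0 < edgesBetween u v → dSentThirds A B v ≤ 4 → Generous v
  mkGenerous {v} v∈B b1 b2 wv≡2 toNotC≡2 0<e dSentThirds≤4 = record
    { v∈B = v∈B ; notB1 = b1 ; notB2 = b2 ; w≡2 = wv≡2 ; light = light ; fewEdges = fewEdges }
    where
    degree≡3 : degree v ≡ 3
    degree≡3 = proj₂ (proj₂ (shape v∈B b1 b2)) wv≡2
    toC : Subset n → ℕ
    toC a = if inC a then edgesBetween a v else 0
    otherToC≡0 : ∑ toC rest ≡ 0
    otherToC≡0 = n≤0⇒n≡0 (+-cancelˡ-≤ 1 _ 0 (+-cancelʳ-≤ 2 _ _ (begin
      1 + ∑ toC rest + 2                   ≤⟨ +-monoˡ-≤ 2 (+-monoˡ-≤ (∑ toC rest) 0<e) ⟩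
      edgesBetween u v + ∑ toC rest + 2    ≡⟨ cong (λ c → (if c then edgesBetween u v else 0) + ∑ toC rest + 2) u∈C ⟨
      toC u + ∑ toC rest + 2               ≡⟨ cong₂ _+_ (∑-↭ toC A↭) toNotC≡2 ⟨
      edgesToC A B v + edgesToNotC v       ≡⟨ edgesToC+edgesToNotC≡degree A B v ⟩
      degree v                             ≡⟨ degree≡3 ⟩
      3                                    ∎)))
      where open ≤-Reasoning
    outsideC : ∀ {a} → a ∈ rest → 0 < edgesBetween a v → inC a ≡ false
    outsideC {a} a∈ 0<ea with inC a in a∈C
    ... | false = refl
    ... | true  = ⊥-elim (<⇒≢ 0<ea (sym (subst (λ c → (if c then edgesBetween a v else 0) ≡ 0) a∈C (∑≡0⇒≡0 toC otherToC≡0 a∈))))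
    light : ∀ {a} → a ∈ rest → 0 < edgesBetween a v → w a ≡ 1
    light {a} a∈ 0<ea with weight≡1⊎2 sizesA (rest⊆A a∈)
    ... | inj₁ wa≡1 = wa≡1
    ... | inj₂ wa≡2 = ⊥-elim (<-irrefl refl (begin-strict
      4               ≡⟨ cong (2 *_) toNotC≡2 ⟨
      2 * edgesToNotC v <⟨ weight2Neighbour⇒2*edgesToNotC<dSentThirds A B (rest⊆A a∈) (outsideC a∈ 0<ea) 0<ea wa≡2 ⟩
      dSentThirds A B v   ≤⟨ dSentThirds≤4 ⟩
      4               ∎))
      where open ≤-Reasoning
    fewEdges : otherEdges v ≤ 2
    fewEdges = +-cancelˡ-≤ 1 _ _ (begin
      1 + otherEdges v                 ≤⟨ +-monoˡ-≤ (otherEdges v) 0<e ⟩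
      edgesBetween u v + otherEdges v  ≡⟨ degree≡ v ⟨
      degree v                         ≡⟨ degree≡3 ⟩
      3                                ∎)
      where open ≤-Reasoning

  Bounded : Subset n → ℚ → ℕ → Set
  Bounded v r k = r ℚ.≤ thirds k ⊎ (Generous v × r ℚ.≤ thirds (2 * k))

  if-inC-u : ∀ {X : Set} {x y : X} → (if inC u then x else y) ≡ x
  if-inC-u {x = x} {y} = cong (λ c → if c then x else y) u∈C

  w≢1⇒w≡2 : ∀ {v} → v ∈ B → w v ≢ 1 → w v ≡ 2
  w≢1⇒w≡2 v∈B w≢1 with weight≡1⊎2 sizesB v∈B
  ... | inj₁ wv≡1 = ⊥-elim (w≢1 wv≡1)
  ... | inj₂ wv≡2 = wv≡2

  edgesBetween-u≤edgesToC : ∀ v → edgesBetween u v ≤ edgesToC A B v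
  edgesBetween-u≤edgesToC v =
    ≤-trans (≤-reflexive (sym if-inC-u)) (≤∑ (λ a → if inC a then edgesBetween a v else 0) u∈A)

  3≤edgesToNotC⇒noEdge : ∀ {v} → v ∈ B → isB1 v ≡ false → isB2 v ≡ false → w v ≡ 2 →
                         3 ≤ edgesToNotC v → edgesBetween u v ≡ 0
  3≤edgesToNotC⇒noEdge {v} v∈B b1 b2 wv≡2 3≤toNotC =
    n≤0⇒n≡0 (≤-trans (edgesBetween-u≤edgesToC v) (+-cancelʳ-≤ 3 _ 0 (begin
      edgesToC A B v + 3              ≤⟨ +-monoʳ-≤ (edgesToC A B v) 3≤toNotC ⟩
      edgesToC A B v + edgesToNotC v  ≡⟨ edgesToC+edgesToNotC≡degree A B v ⟩
      degree v                        ≡⟨ proj₂ (proj₂ (shape v∈B b1 b2)) wv≡2 ⟩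
      3                               ∎)))
    where open ≤-Reasoning

  step2Core-bound : ∀ {v} → v ∈ B → isB1 v ≡ false → isB2 v ≡ false →
                    Bounded v (step2Core u v) (edgesBetween u v)
  step2Core-bound {v} v∈B b1 b2 with w v ≟ 1 | edgesToNotC v in toNotC≡
  ... | yes _ | _ with meets u v in m
  ...   | true  = inj₁ (ℚ.≤-trans (ℚ.≤-reflexive (trans if-inC-u (sym thirds-1))) (thirds-mono-≤ (meets⇒0< u v m)))
  ...   | false = inj₁ (thirds-nonNeg (edgesBetween u v))
  step2Core-bound {v} v∈B b1 b2 | no _ | 0 =
    ⊥-elim (<⇒≢ (neighbourOutsideC⇒0<edgesToNotC A B (proj₁ (shape v∈B b1 b2))) (sym toNotC≡))
  step2Core-bound {v} v∈B b1 b2 | no _ | 1 = inj₁ (ℚ.≤-reflexive (trans (cong (q (edgesBetween u v) ℚ.*_) if-inC-u) (fromℕ*oneThird≡thirds (edgesBetween u v))))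
  step2Core-bound {v} v∈B b1 b2 | no w≢1 | 2 = subst (λ r → Bounded v r (edgesBetween u v)) (sym if-inC-u) dCase
    where
    wv≡2 : w v ≡ 2
    wv≡2 = w≢1⇒w≡2 v∈B w≢1
    4≤dSentThirds : 4 ≤ dSentThirds A B v
    4≤dSentThirds = subst (λ k → 2 * k ≤ dSentThirds A B v) toNotC≡ (2*edgesToNotC≤dSentThirds A B v)
    dRemaining≡ : dRemaining v ≡ thirds (6 ∸ dSentThirds A B v)
    dRemaining≡ = dRemaining≡thirds A B v (subst (λ k → dSentThirds A B v ≤ 3 * k) toNotC≡ (dSentThirds≤3*edgesToNotC A B v))
    dCase : Bounded v (if meets u v then dRemaining v else ℚ.0ℚ) (edgesBetween u v)
    dCase with meets u v in m
    ... | false = inj₁ (thirds-nonNeg (edgesBetween u v))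
    ... | true with dSentThirds A B v ≤? 4
    ...   | yes dSentThirds≤4 = inj₂ (mkGenerous v∈B b1 b2 wv≡2 toNotC≡ 0<e dSentThirds≤4 ,
                                  ℚ.≤-trans (ℚ.≤-reflexive dRemaining≡) (thirds-mono-≤ (≤-trans (∸-monoʳ-≤ 6 4≤dSentThirds) (*-monoʳ-≤ 2 0<e))))
      where
      0<e : 0 < edgesBetween u v
      0<e = meets⇒0< u v m
    ...   | no dSentThirds≰4  = inj₁ (ℚ.≤-trans (ℚ.≤-reflexive dRemaining≡) (thirds-mono-≤ (≤-trans (∸-monoʳ-≤ 6 (≰⇒> dSentThirds≰4)) (meets⇒0< u v m))))
  step2Core-bound {v} v∈B b1 b2 | no w≢1 | suc (suc (suc k)) = inj₁ (ℚ.≤-reflexive (begin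
    q (edgesBetween u v) ℚ.* twoThirds  ≡⟨ cong (q (edgesBetween u v) ℚ.*_) thirds-2 ⟨
    q (edgesBetween u v) ℚ.* thirds 2   ≡⟨ thirds-* (edgesBetween u v) 2 ⟨
    thirds (edgesBetween u v * 2)       ≡⟨ cong thirds (trans (cong (_* 2) e≡0) (sym e≡0)) ⟩
    thirds (edgesBetween u v)           ∎))
    where
    open ≡-Reasoning
    e≡0 : edgesBetween u v ≡ 0
    e≡0 = 3≤edgesToNotC⇒noEdge v∈B b1 b2 (w≢1⇒w≡2 v∈B w≢1) (≤-trans (m≤m+n 3 k) (≤-reflexive (sym toNotC≡)))

  step2From-bound : ∀ {v} → v ∈ B → Bounded v (step2From u v) (step2Edges v)
  step2From-bound {v} v∈B = bySet (isB1 v) (isB2 v) refl refl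
    where
    bySet : ∀ x y → isB1 v ≡ x → isB2 v ≡ y →
            Bounded v (if x then ℚ.0ℚ else if y then ℚ.0ℚ else step2Core u v)
                      (if x then 0 else if y then 0 else edgesBetween u v)
    bySet true  _     _  _  = inj₁ (thirds-nonNeg 0)
    bySet false true  _  _  = inj₁ (thirds-nonNeg 0)
    bySet false false b1 b2 = step2Core-bound v∈B b1 b2

  step2From≤thirds-2*step2Edges : ∀ {v} → v ∈ B → step2From u v ℚ.≤ thirds (2 * step2Edges v)
  step2From≤thirds-2*step2Edges {v} v∈B =
    [ (λ r≤ → ℚ.≤-trans r≤ (thirds-mono-≤ (m≤n*m (step2Edges v) 2))) , proj₂ ]′ (step2From-bound v∈B)

  step2From≤thirds-step2Edges : ∀ {v} → v ∈ B → ¬ Generous v → step2From u v ℚ.≤ thirds (step2Edges v)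
  step2From≤thirds-step2Edges v∈B ¬gen = [ id , (λ (gen , _) → ⊥-elim (¬gen gen)) ]′ (step2From-bound v∈B)

  received1≡w : received1 u ≡ w u
  received1≡w = does≡true⇒ (received1 u ≟ w u) u∈C

  ∑step1Edges+∑step2Edges≤∣u∣ : ∑ step1Edges B + ∑ step2Edges B ≤ ∣ u ∣
  ∑step1Edges+∑step2Edges≤∣u∣ = begin
    ∑ step1Edges B + ∑ step2Edges B                 ≡⟨ ∑-+ step1Edges step2Edges B ⟨
    ∑ (λ b → step1Edges b + step2Edges b) B         ≡⟨ ∑-cong B (λ {b} _ → step1Edges+step2Edges≡ b) ⟩
    ∑ (λ b → ∣ u ∩ b ∣) B                           ≤⟨ ∑∣p∩q∣≤∣p∣ u (proj₂ B-feasible) ⟩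
    ∣ u ∣                                           ∎
    where open ≤-Reasoning

  replacement⇒∑step2Edges≤w : ∀ {b} → b ∈ B → Replaces b → ∑ step2Edges B ≤ w u
  replacement⇒∑step2Edges≤w b∈B rep = m+n≤o⇒m≤o∸n (∑ step2Edges B) (begin
    ∑ step2Edges B + 1                ≡⟨ +-comm (∑ step2Edges B) 1 ⟩
    1 + ∑ step2Edges B                ≤⟨ +-monoˡ-≤ (∑ step2Edges B) (≤-trans (Replaces.step1Edge rep) (≤∑ step1Edges b∈B)) ⟩
    ∑ step1Edges B + ∑ step2Edges B   ≤⟨ ∑step1Edges+∑step2Edges≤∣u∣ ⟩
    ∣ u ∣                             ∎)
    where open ≤-Reasoning

  module _ (none : ¬ Any Replaces B) where

    private
      ¬replaces : ∀ {b} → b ∈ B → ¬ Replaces b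
      ¬replaces b∈B rep = none (lose b∈B rep)

    noReplacement⇒∣u∣≡3 : ∣ u ∣ ≡ 3
    noReplacement⇒∣u∣≡3 with sizesA u∈A
    ... | inj₂ ∣u∣≡3 = ∣u∣≡3
    ... | inj₁ ∣u∣≡2 = ⊥-elim (0≢1+n (begin
      0              ≡⟨ ≡0⇒∑≡0 (step1From u) B (λ b∈B → step1From≡0 ∣u∣≡2 b∈B (¬replaces b∈B)) ⟨
      received1 u    ≡⟨ received1≡w ⟩
      w u            ≡⟨ cong (_∸ 1) ∣u∣≡2 ⟩
      1              ∎))
      where open ≡-Reasoning

    noReplacement⇒∑step2Edges≤1 : ∑ step2Edges B ≤ 1
    noReplacement⇒∑step2Edges≤1 = +-cancelˡ-≤ 2 _ _ (begin
      2 + ∑ step2Edges B                ≡⟨ cong (λ k → k ∸ 1 + ∑ step2Edges B) noReplacement⇒∣u∣≡3 ⟨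
      w u + ∑ step2Edges B              ≡⟨ cong (_+ ∑ step2Edges B) received1≡w ⟨
      received1 u + ∑ step2Edges B      ≤⟨ +-monoˡ-≤ (∑ step2Edges B) (∑-mono B (λ b∈B → step1From≤step1Edges b∈B (¬replaces b∈B))) ⟩
      ∑ step1Edges B + ∑ step2Edges B   ≤⟨ ∑step1Edges+∑step2Edges≤∣u∣ ⟩
      ∣ u ∣                             ≡⟨ noReplacement⇒∣u∣≡3 ⟩
      3                                 ∎)
      where open ≤-Reasoning

  ∑step2From≤thirds-w : ∑ℚ (step2From u) B ℚ.≤ thirds (w u)
  ∑step2From≤thirds-w = byReplacement (any? replaces? B)
    where
    byReplacement : Dec (Any Replaces B) → ∑ℚ (step2From u) B ℚ.≤ thirds (w u)
    byReplacement (yes some) with find some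
    ... | b , b∈B , rep = ℚ.≤-trans
      (∑ℚ≤thirds∑ (step2From u) step2Edges B (λ v∈B → step2From≤thirds-step2Edges v∈B (replaces⇒¬generous b∈B rep)))
      (thirds-mono-≤ (replacement⇒∑step2Edges≤w b∈B rep))
    byReplacement (no none) = ℚ.≤-trans
      (∑ℚ≤thirds∑ (step2From u) (λ v → 2 * step2Edges v) B step2From≤thirds-2*step2Edges)
      (thirds-mono-≤ (begin
        ∑ (λ v → 2 * step2Edges v) B  ≡⟨ ∑-* 2 step2Edges B ⟩
        2 * ∑ step2Edges B            ≤⟨ *-monoʳ-≤ 2 (noReplacement⇒∑step2Edges≤1 none) ⟩
        2                             ≡⟨ cong (_∸ 1) (noReplacement⇒∣u∣≡3 none) ⟨
        w u                           ∎))
      where open ≤-Reasoning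

  receivedTotal≤ : receivedTotal u ℚ.≤ fourThirds ℚ.* q (w u)
  receivedTotal≤ = begin
    receivedTotal u                          ≡⟨ cong (λ k → q k ℚ.+ ∑ℚ (step2From u) B) received1≡w ⟩
    q (w u) ℚ.+ ∑ℚ (step2From u) B           ≤⟨ ℚ.+-monoʳ-≤ (q (w u)) ∑step2From≤thirds-w ⟩
    q (w u) ℚ.+ thirds (w u)                 ≡⟨ fromℕ+thirds≡4/3* (w u) ⟩
    fourThirds ℚ.* q (w u)                   ∎
    where open ℚ.≤-Reasoning

lemma5 : {n : ℕ} (S A B : List (Subset n)) →
         Hereditary3SP S →
         Feasible S A →
         NoLocalImprovementUpTo 10 S A →
         Optimum S B →
         (∀ {a} → a ∈ A → ∣ a ∣ ≡ 2 ⊎ ∣ a ∣ ≡ 3) →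
         (∀ {b} → b ∈ B → ∣ b ∣ ≡ 2 ⊎ ∣ b ∣ ≡ 3) →
         let open ConflictGraph A B in
         (∀ {v} → v ∈ B → isB1 v ≡ false → isB2 v ≡ false →
            Any (λ a → inC a ≡ false × meets a v ≡ true) A
            × (w v ≡ 1 → length (nbrs v) ≡ 2)
            × (w v ≡ 2 → degree v ≡ 3)) →
         ∀ {u} → u ∈ A → inC u ≡ true →
         receivedTotal u ℚ.≤ fourThirds ℚ.* q (w u)
lemma5 S A B her _ noImprovement (B-feasible , _) sizesA sizesB shape u∈A u∈C
  with rest , A↭ ← ∈⇒↭∷ u∈A =
  Charging.receivedTotal≤ her noImprovement B-feasible sizesA sizesB shape A↭ u∈C
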